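{- For every $n\ge1$, $\bigl|\mathrm{cycles}^{(1)}(1)\bigr|=\varphi(n)$, where $\varphi$ is Euler's totient function.
   Context: Let $\sigma\in S_n$ be $\sigma(i)=i+1$ for $i<n$, $\sigma(n)=1$. For $\pi\in S_n$ let $\mathrm{inc}(\pi)=\{\sigma^k\circ\pi:0\le k\le n-1\}$; these sets are the classes of an equivalence relation on $S_n$. The map $f(\mathrm{inc}(\pi))=\mathrm{inc}(\pi\circ\sigma)$ is a well-defined permutation of the set of classes. A 1-cycle is an orbit of $f$; $\mathrm{cycles}^{(1)}(1)$ is the set of 1-cycles of length 1, i.e. classes fixed by $f$. -}

module Defs where

open import Data.Nat using (ℕ; zero; suc; _<_)
open import Data.Nat.DivMod using (_mod_)
open import Data.Nat.Coprimality using (coprime?)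
open import Data.Fin using (Fin; toℕ)
open import Data.List using (length; filter; applyUpTo)
open import Data.Product using (Σ; _×_; ∃)
open import Function using (_∘_; _⇔_)
open import Function.Definitions using (Injective)
open import Relation.Binary.PropositionalEquality using (_≡_)

φ : ℕ → ℕ
φ n = length (filter (λ k → coprime? k n) (applyUpTo suc n))

-- Elements of S_n: bijections of Fin n (= injective self-maps of a finite set)
record Perm (n : ℕ) : Set where
  constructor perm
  field
    fun : Fin n → Fin n
    inj : Injective _≡_ _≡_ fun
open Perm public

-- the cyclic shift σ(i) = i+1 (mod n) on Fin n (0-indexed version of i ↦ i+1, n ↦ 1)
σ : ∀ {n} → Fin n → Fin n
σ {suc m} i = suc (toℕ i) mod (suc m)

iter : ∀ {A : Set} → ℕ → (A → A) → A → A
iter zero    g x = x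
iter (suc k) g x = g (iter k g x)

_∈inc_ : ∀ {n} → Perm n → (Fin n → Fin n) → Set
_∈inc_ {n} τ f = ∃ λ k → k < n × (∀ i → fun τ i ≡ iter k σ (f i))

SameClass : ∀ {n} → (Fin n → Fin n) → (Fin n → Fin n) → Set
SameClass {n} f g = (τ : Perm n) → (τ ∈inc f) ⇔ (τ ∈inc g)

-- the class inc(π) is fixed by f : inc(π) ↦ inc(π ∘ σ)
FixedClass : ∀ {n} → Perm n → Set
FixedClass π = SameClass (fun π ∘ σ) (fun π)

-- |cycles⁽¹⁾(1)| = c : there are exactly c pairwise distinct classes fixed by f,
-- witnessed by representatives r : Fin c → S_n hitting every fixed class exactly once
NumFixedClasses : ℕ → ℕ → Set
NumFixedClasses n c =
  Σ (Fin c → Perm n) λ r →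
      (∀ j → FixedClass (r j))
    × (∀ j j' → SameClass (fun (r j)) (fun (r j')) → j ≡ j')
    × (∀ π → FixedClass π → ∃ λ j → SameClass (fun π) (fun (r j)))

module Submission where

-- A class inc(π) is fixed exactly when π ∘ σ = σᶜ ∘ π for some c. Walking along
-- 0, 1, 2, … this forces π(i) = p + c·i (mod n), and injectivity of π forces c to be
-- a unit mod n. Conversely each affine map i ↦ c·i with c a unit is a permutation
-- whose class is fixed, and two such maps lie in the same class only if their slopes
-- agree mod n (compare the values at 0 and 1). So the fixed classes correspond to the
-- units in {1,…,n}, of which there are φ(n).

open import Defs
open import Data.Nat using (ℕ; zero; suc; _+_; _*_; _∸_; _≤_; _<_; s≤s; z≤n; NonZero)
open import Data.Nat.Properties
open import Data.Nat.DivMod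
open import Data.Nat.Divisibility using (_∣_; divides; m%n≡0⇒n∣m; n∣m⇒m%n≡0; ∣-antisym)
open import Data.Nat.Coprimality using (Coprime; coprime?; coprime-divisor)
  renaming (sym to coprime-sym)
open import Data.Fin using (Fin; toℕ) renaming (zero to fzero; suc to fsuc)
open import Data.Fin.Properties using (toℕ-injective; toℕ-fromℕ<; toℕ<n)
open import Data.List using (List; _∷_; length; filter; applyUpTo; lookup)
open import Data.List.Relation.Unary.All as All using ()
open import Data.List.Relation.Unary.AllPairs using (_∷_)
open import Data.List.Relation.Unary.Unique.Propositional using (Unique)
import Data.List.Relation.Unary.Unique.Propositional.Properties as Unique
open import Data.List.Relation.Unary.Any using (index)
open import Data.List.Relation.Unary.Any.Properties using (lookup-index)
open import Data.List.Membership.Propositional using (_∈_)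
open import Data.List.Membership.Propositional.Properties
  using (∈-lookup; ∈-filter⁺; ∈-filter⁻; ∈-applyUpTo⁺; ∈-applyUpTo⁻)
open import Data.Product using (∃; _×_; _,_; proj₂)
open import Data.Sum using (inj₁; inj₂)
open import Data.Empty using (⊥-elim)
open import Function using (_∘_)
open import Function.Bundles using (mk⇔; Equivalence)
open import Function.Definitions using (Injective)
open import Relation.Binary.PropositionalEquality

[m+n%d]%d≡[m+n]%d : ∀ m n d .{{_ : NonZero d}} → (m + n % d) % d ≡ (m + n) % d
[m+n%d]%d≡[m+n]%d m n d = begin
  (m + n % d) % d            ≡⟨ %-distribˡ-+ m (n % d) d ⟩
  (m % d + n % d % d) % d    ≡⟨ cong (λ x → (m % d + x) % d) (m%n%n≡m%n n d) ⟩
  (m % d + n % d) % d        ≡⟨ %-distribˡ-+ m n d ⟨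
  (m + n) % d                ∎
  where open ≡-Reasoning

[m*n%d]%d≡[m*n]%d : ∀ m n d .{{_ : NonZero d}} → (m * (n % d)) % d ≡ (m * n) % d
[m*n%d]%d≡[m*n]%d m n d = begin
  (m * (n % d)) % d          ≡⟨ %-distribˡ-* m (n % d) d ⟩
  (m % d * (n % d % d)) % d  ≡⟨ cong (λ x → (m % d * x) % d) (m%n%n≡m%n n d) ⟩
  (m % d * (n % d)) % d      ≡⟨ %-distribˡ-* m n d ⟨
  (m * n) % d                ∎
  where open ≡-Reasoning

[d∸m%d+m]%d≡0 : ∀ m d .{{_ : NonZero d}} → (d ∸ m % d + m) % d ≡ 0
[d∸m%d+m]%d≡0 m d = begin
  (d ∸ m % d + m) % d        ≡⟨ [m+n%d]%d≡[m+n]%d (d ∸ m % d) m d ⟨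
  (d ∸ m % d + m % d) % d    ≡⟨ cong (_% d) (m∸n+n≡m (m%n≤n m d)) ⟩
  d % d                      ≡⟨ n%n≡0 d ⟩
  0                          ∎
  where open ≡-Reasoning

+-cancelˡ-% : ∀ m n o d .{{_ : NonZero d}} → (m + n) % d ≡ (m + o) % d → n % d ≡ o % d
+-cancelˡ-% m n o d eq = begin
  n % d                          ≡⟨ add-m⁻ n ⟨
  ((m + n) % d + m⁻) % d         ≡⟨ cong (λ x → (x + m⁻) % d) eq ⟩
  ((m + o) % d + m⁻) % d         ≡⟨ add-m⁻ o ⟩
  o % d                          ∎
  where
  open ≡-Reasoning
  m⁻ : ℕ
  m⁻ = d ∸ m % d
  add-m⁻ : ∀ n → ((m + n) % d + m⁻) % d ≡ n % d
  add-m⁻ n = begin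
    ((m + n) % d + m⁻) % d       ≡⟨ cong (_% d) (+-comm ((m + n) % d) m⁻) ⟩
    (m⁻ + (m + n) % d) % d       ≡⟨ [m+n%d]%d≡[m+n]%d m⁻ (m + n) d ⟩
    (m⁻ + (m + n)) % d           ≡⟨ cong (_% d) (trans (sym (+-assoc m⁻ m n)) (+-comm (m⁻ + m) n)) ⟩
    (n + (m⁻ + m)) % d           ≡⟨ [m+n%d]%d≡[m+n]%d n (m⁻ + m) d ⟨
    (n + (m⁻ + m) % d) % d       ≡⟨ cong (λ x → (n + x) % d) ([d∸m%d+m]%d≡0 m d) ⟩
    (n + 0) % d                  ≡⟨ cong (_% d) (+-identityʳ n) ⟩
    n % d                        ∎

lookup-injective : ∀ {A : Set} {xs : List A} → Unique xs → ∀ {i j} → lookup xs i ≡ lookup xs j → i ≡ j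
lookup-injective (x∉xs ∷ u) {fzero} {fzero} eq = refl
lookup-injective (x∉xs ∷ u) {fzero} {fsuc j} eq = ⊥-elim (All.lookup x∉xs (∈-lookup j) eq)
lookup-injective (x∉xs ∷ u) {fsuc i} {fzero} eq = ⊥-elim (All.lookup x∉xs (∈-lookup i) (sym eq))
lookup-injective (x∉xs ∷ u) {fsuc i} {fsuc j} eq = cong fsuc (lookup-injective u eq)

iter-+ : ∀ {A : Set} (g : A → A) a b x → iter (a + b) g x ≡ iter a g (iter b g x)
iter-+ g zero    b x = refl
iter-+ g (suc a) b x = cong g (iter-+ g a b x)

module Cyclic (m : ℕ) where

  N : ℕ
  N = suc m

  toℕ-mod : ∀ a → toℕ (a mod N) ≡ a % N
  toℕ-mod a = toℕ-fromℕ< (m%n<n a N)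

  toℕ%N : ∀ (i : Fin N) → toℕ i % N ≡ toℕ i
  toℕ%N i = m<n⇒m%n≡m (toℕ<n i)

  toℕ-iter-σ : ∀ a (x : Fin N) → toℕ (iter a σ x) ≡ (toℕ x + a) % N
  toℕ-iter-σ zero    x = sym (trans (cong (_% N) (+-identityʳ (toℕ x))) (toℕ%N x))
  toℕ-iter-σ (suc a) x = begin
    toℕ (σ (iter a σ x))          ≡⟨ toℕ-mod (suc (toℕ (iter a σ x))) ⟩
    (1 + toℕ (iter a σ x)) % N    ≡⟨ cong (λ y → (1 + y) % N) (toℕ-iter-σ a x) ⟩
    (1 + (toℕ x + a) % N) % N     ≡⟨ [m+n%d]%d≡[m+n]%d 1 (toℕ x + a) N ⟩
    (1 + (toℕ x + a)) % N         ≡⟨ cong (_% N) (+-suc (toℕ x) a) ⟨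
    (toℕ x + suc a) % N           ∎
    where open ≡-Reasoning

  iter-σ-cong : ∀ {a b} → a % N ≡ b % N → ∀ x → iter a σ x ≡ iter b σ x
  iter-σ-cong {a} {b} a≡b x = toℕ-injective (begin
    toℕ (iter a σ x)          ≡⟨ toℕ-iter-σ a x ⟩
    (toℕ x + a) % N           ≡⟨ [m+n%d]%d≡[m+n]%d (toℕ x) a N ⟨
    (toℕ x + a % N) % N       ≡⟨ cong (λ y → (toℕ x + y) % N) a≡b ⟩
    (toℕ x + b % N) % N       ≡⟨ [m+n%d]%d≡[m+n]%d (toℕ x) b N ⟩
    (toℕ x + b) % N           ≡⟨ toℕ-iter-σ b x ⟨
    toℕ (iter b σ x)          ∎)
    where open ≡-Reasoning

  iter-σ-fzero : ∀ (x : Fin N) → iter (toℕ x) σ fzero ≡ x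
  iter-σ-fzero x = toℕ-injective (trans (toℕ-iter-σ (toℕ x) fzero) (toℕ%N x))

  σ-injective : Injective _≡_ _≡_ (σ {N})
  σ-injective {x} {y} σx≡σy = toℕ-injective (begin
    toℕ x          ≡⟨ toℕ%N x ⟨
    toℕ x % N      ≡⟨ +-cancelˡ-% 1 (toℕ x) (toℕ y) N 1+x≡1+y ⟩
    toℕ y % N      ≡⟨ toℕ%N y ⟩
    toℕ y          ∎)
    where
    open ≡-Reasoning
    1+x≡1+y : (1 + toℕ x) % N ≡ (1 + toℕ y) % N
    1+x≡1+y = trans (sym (toℕ-mod (suc (toℕ x)))) (trans (cong toℕ σx≡σy) (toℕ-mod (suc (toℕ y))))

  σ-mod : ∀ t → σ (t mod N) ≡ suc t mod N
  σ-mod t = toℕ-injective (begin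
    toℕ (σ (t mod N))           ≡⟨ toℕ-mod (suc (toℕ (t mod N))) ⟩
    (1 + toℕ (t mod N)) % N     ≡⟨ cong (λ y → (1 + y) % N) (toℕ-mod t) ⟩
    (1 + t % N) % N             ≡⟨ [m+n%d]%d≡[m+n]%d 1 t N ⟩
    suc t % N                   ≡⟨ toℕ-mod (suc t) ⟨
    toℕ (suc t mod N)           ∎)
    where open ≡-Reasoning

  toℕ-mod-id : ∀ (i : Fin N) → toℕ i mod N ≡ i
  toℕ-mod-id i = toℕ-injective (trans (toℕ-mod (toℕ i)) (toℕ%N i))

  Shifted : (f g : Fin N → Fin N) → ℕ → Set
  Shifted f g a = ∀ i → f i ≡ iter a σ (g i)

  shifted-trans : ∀ {f g h a b} → Shifted f g a → Shifted g h b → Shifted f h (a + b)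
  shifted-trans {f} {g} {h} {a} {b} shf shg i = begin
    f i                        ≡⟨ shf i ⟩
    iter a σ (g i)             ≡⟨ cong (iter a σ) (shg i) ⟩
    iter a σ (iter b σ (h i))  ≡⟨ iter-+ σ a b (h i) ⟨
    iter (a + b) σ (h i)       ∎
    where open ≡-Reasoning

  shifted-cong : ∀ {f g a b} → a % N ≡ b % N → Shifted f g a → Shifted f g b
  shifted-cong {g = g} {a} {b} a≡b sh i = trans (sh i) (iter-σ-cong {a} {b} a≡b (g i))

  shifted-sym : ∀ {f g a} → Shifted f g a → Shifted g f (N ∸ a % N)
  shifted-sym {f} {g} {a} sh i = begin
    g i                                  ≡⟨ iter-σ-cong {N ∸ a % N + a} {0} ([d∸m%d+m]%d≡0 a N) (g i) ⟨
    iter (N ∸ a % N + a) σ (g i)         ≡⟨ iter-+ σ (N ∸ a % N) a (g i) ⟩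
    iter (N ∸ a % N) σ (iter a σ (g i))  ≡⟨ cong (iter (N ∸ a % N) σ) (sh i) ⟨
    iter (N ∸ a % N) σ (f i)             ∎
    where open ≡-Reasoning

  shifted⇒∈inc : ∀ {f g a} → Shifted f g a → (τ : Perm N) → τ ∈inc f → τ ∈inc g
  shifted⇒∈inc {a = a} sh τ (k , _ , τ≡σᵏf) =
    (k + a) % N , m%n<n (k + a) N ,
    shifted-cong {a = k + a} {b = (k + a) % N} (sym (m%n%n≡m%n (k + a) N))
      (shifted-trans {a = k} {b = a} τ≡σᵏf sh)

  shifted⇒sameClass : ∀ {f g a} → Shifted f g a → SameClass f g
  shifted⇒sameClass {a = a} sh τ =
    mk⇔ (shifted⇒∈inc {a = a} sh τ) (shifted⇒∈inc {a = N ∸ a % N} (shifted-sym {a = a} sh) τ)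

  shifted-injective : ∀ {f g a} → Shifted f g a → Injective _≡_ _≡_ f → Injective _≡_ _≡_ g
  shifted-injective {a = a} sh f-inj {i} {j} gi≡gj =
    f-inj (trans (sh i) (trans (cong (iter a σ) gi≡gj) (sym (sh j))))

  scale : ℕ → Fin N → Fin N
  scale c i = (c * toℕ i) mod N

  toℕ-scale-≡ : ∀ {c i j} → scale c i ≡ scale c j → (c * toℕ i) % N ≡ (c * toℕ j) % N
  toℕ-scale-≡ {c} {i} {j} eq = trans (sym (toℕ-mod (c * toℕ i))) (trans (cong toℕ eq) (toℕ-mod (c * toℕ j)))

  scale-fzero : ∀ c → scale c fzero ≡ fzero
  scale-fzero c = toℕ-injective (trans (toℕ-mod (c * 0)) (cong (_% N) (*-zeroʳ c)))

  toℕ-scale-1 : ∀ c → toℕ (scale c (1 mod N)) ≡ c % N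
  toℕ-scale-1 c = begin
    toℕ (scale c (1 mod N))     ≡⟨ toℕ-mod (c * toℕ (1 mod N)) ⟩
    (c * toℕ (1 mod N)) % N     ≡⟨ cong (λ y → (c * y) % N) (toℕ-mod 1) ⟩
    (c * (1 % N)) % N           ≡⟨ [m*n%d]%d≡[m*n]%d c 1 N ⟩
    (c * 1) % N                 ≡⟨ cong (_% N) (*-identityʳ c) ⟩
    c % N                       ∎
    where open ≡-Reasoning

  scale-iter-σ : ∀ c i → scale c i ≡ iter (c * toℕ i) σ fzero
  scale-iter-σ c i = toℕ-injective (trans (toℕ-mod (c * toℕ i)) (sym (toℕ-iter-σ (c * toℕ i) fzero)))

  scale-∘-σ : ∀ c → Shifted (scale c ∘ σ) (scale c) c
  scale-∘-σ c i = toℕ-injective (begin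
    toℕ (scale c (σ i))               ≡⟨ toℕ-mod (c * toℕ (σ i)) ⟩
    (c * toℕ (σ i)) % N               ≡⟨ cong (λ y → (c * y) % N) (toℕ-mod (suc (toℕ i))) ⟩
    (c * (suc (toℕ i) % N)) % N       ≡⟨ [m*n%d]%d≡[m*n]%d c (suc (toℕ i)) N ⟩
    (c * suc (toℕ i)) % N             ≡⟨ cong (_% N) (*-suc c (toℕ i)) ⟩
    (c + c * toℕ i) % N               ≡⟨ [m+n%d]%d≡[m+n]%d c (c * toℕ i) N ⟨
    (c + (c * toℕ i) % N) % N         ≡⟨ cong (_% N) (+-comm c ((c * toℕ i) % N)) ⟩
    ((c * toℕ i) % N + c) % N         ≡⟨ cong (λ y → (y + c) % N) (toℕ-mod (c * toℕ i)) ⟨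
    (toℕ (scale c i) + c) % N         ≡⟨ toℕ-iter-σ c (scale c i) ⟨
    toℕ (iter c σ (scale c i))        ∎)
    where open ≡-Reasoning

  coprime-*-cancel-≤ : ∀ {c a b} → Coprime c N → a ≤ b → b < N → (c * a) % N ≡ (c * b) % N → a ≡ b
  coprime-*-cancel-≤ {c} {a} {b} c⊥N a≤b b<N ca≡cb = begin
    a               ≡⟨ +-identityʳ a ⟨
    a + 0           ≡⟨ cong (a +_) d≡0 ⟨
    a + (b ∸ a)     ≡⟨ m+[n∸m]≡n a≤b ⟩
    b               ∎
    where
    open ≡-Reasoning
    d : ℕ
    d = b ∸ a
    cd%N≡0 : (c * d) % N ≡ 0
    cd%N≡0 = sym (+-cancelˡ-% (c * a) 0 (c * d) N (begin
      (c * a + 0) % N       ≡⟨ cong (_% N) (+-identityʳ (c * a)) ⟩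
      (c * a) % N           ≡⟨ ca≡cb ⟩
      (c * b) % N           ≡⟨ cong (λ x → (c * x) % N) (m+[n∸m]≡n a≤b) ⟨
      (c * (a + d)) % N     ≡⟨ cong (_% N) (*-distribˡ-+ c a d) ⟩
      (c * a + c * d) % N   ∎))
    N∣d : N ∣ d
    N∣d = coprime-divisor (coprime-sym c⊥N) (m%n≡0⇒n∣m (c * d) N cd%N≡0)
    d≡0 : d ≡ 0
    d≡0 = trans (sym (m<n⇒m%n≡m (≤-<-trans (m∸n≤m b a) b<N))) (n∣m⇒m%n≡0 d N N∣d)

  coprime⇒scale-injective : ∀ {c} → Coprime c N → Injective _≡_ _≡_ (scale c)
  coprime⇒scale-injective {c} c⊥N {i} {j} ci≡cj with ≤-total (toℕ i) (toℕ j)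
  ... | inj₁ i≤j = toℕ-injective (coprime-*-cancel-≤ c⊥N i≤j (toℕ<n j) (toℕ-scale-≡ {c} ci≡cj))
  ... | inj₂ j≤i = sym (toℕ-injective (coprime-*-cancel-≤ c⊥N j≤i (toℕ<n i) (toℕ-scale-≡ {c} (sym ci≡cj))))

  scale-injective⇒coprime : ∀ c → Injective _≡_ _≡_ (scale c) → Coprime c N
  scale-injective⇒coprime c c-inj {d} (divides f c≡fd , divides g N≡gd) =
    *-cancelˡ-≡ d 1 N (trans (cong (_* d) (sym g≡N)) (trans (sym N≡gd) (sym (*-identityʳ N))))
    where
    open ≡-Reasoning
    cg≡fN : c * g ≡ f * N
    cg≡fN = begin
      c * g         ≡⟨ cong (_* g) c≡fd ⟩
      f * d * g     ≡⟨ *-assoc f d g ⟩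
      f * (d * g)   ≡⟨ cong (f *_) (trans (*-comm d g) (sym N≡gd)) ⟩
      f * N         ∎
    -- scale c sends g to 0, so N ∣ g by injectivity; and g ∣ N
    g≡N : g ≡ N
    g≡N = ∣-antisym (divides d (trans N≡gd (*-comm g d))) (m%n≡0⇒n∣m g N g%N≡0)
      where
      scale-g≡0 : scale c (g mod N) ≡ scale c fzero
      scale-g≡0 = toℕ-injective (begin
        toℕ (scale c (g mod N))   ≡⟨ toℕ-mod (c * toℕ (g mod N)) ⟩
        (c * toℕ (g mod N)) % N   ≡⟨ cong (λ x → (c * x) % N) (toℕ-mod g) ⟩
        (c * (g % N)) % N         ≡⟨ [m*n%d]%d≡[m*n]%d c g N ⟩
        (c * g) % N               ≡⟨ cong (_% N) cg≡fN ⟩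
        (f * N) % N               ≡⟨ m*n%n≡0 f N ⟩
        0                         ≡⟨ cong toℕ (scale-fzero c) ⟨
        toℕ (scale c fzero)       ∎)
      g%N≡0 : g % N ≡ 0
      g%N≡0 = trans (sym (toℕ-mod g)) (cong toℕ (c-inj scale-g≡0))

  scalePerm : ∀ c → Coprime c N → Perm N
  scalePerm c c⊥N = perm (scale c) (coprime⇒scale-injective c⊥N)

  shifted-scale⇒≡% : ∀ c c' {k} → Shifted (scale c) (scale c') k → c % N ≡ c' % N
  shifted-scale⇒≡% c c' {k} sh = begin
    c % N                             ≡⟨ toℕ-scale-1 c ⟨
    toℕ (scale c one)                 ≡⟨ cong toℕ (sh one) ⟩
    toℕ (iter k σ (scale c' one))     ≡⟨ cong toℕ (iter-σ-cong {k} {0} k%N≡0 (scale c' one)) ⟩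
    toℕ (scale c' one)                ≡⟨ toℕ-scale-1 c' ⟩
    c' % N                            ∎
    where
    open ≡-Reasoning
    one : Fin N
    one = 1 mod N
    k%N≡0 : k % N ≡ 0
    k%N≡0 = begin
      k % N                           ≡⟨ toℕ-iter-σ k fzero ⟨
      toℕ (iter k σ fzero)            ≡⟨ cong (toℕ ∘ iter k σ) (scale-fzero c') ⟨
      toℕ (iter k σ (scale c' fzero)) ≡⟨ cong toℕ (sh fzero) ⟨
      toℕ (scale c fzero)             ≡⟨ cong toℕ (scale-fzero c) ⟩
      0                               ∎

  sameClass-scale⇒≡% : ∀ c c' → Coprime c N → SameClass (scale c) (scale c') → c % N ≡ c' % N
  sameClass-scale⇒≡% c c' c⊥N same =
    let k , _ , sh = Equivalence.to (same (scalePerm c c⊥N)) (0 , s≤s z≤n , λ _ → refl)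
    in shifted-scale⇒≡% c c' {k} sh

  -- Following i ↦ σ i from 0 reaches every point, so f is determined by f 0 and the step c.
  shifted-σ⇒affine : ∀ {f} c → Shifted (f ∘ σ) f c → Shifted f (scale c) (toℕ (f fzero))
  shifted-σ⇒affine {f} c sh i = begin
    f i                                   ≡⟨ cong f (toℕ-mod-id i) ⟨
    f (toℕ i mod N)                       ≡⟨ along (toℕ i) ⟩
    iter (c * toℕ i) σ (f fzero)          ≡⟨ cong (iter (c * toℕ i) σ) (iter-σ-fzero (f fzero)) ⟨
    iter (c * toℕ i) σ (iter p σ fzero)   ≡⟨ iter-+ σ (c * toℕ i) p fzero ⟨
    iter (c * toℕ i + p) σ fzero          ≡⟨ cong (λ a → iter a σ fzero) (+-comm (c * toℕ i) p) ⟩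
    iter (p + c * toℕ i) σ fzero          ≡⟨ iter-+ σ p (c * toℕ i) fzero ⟩
    iter p σ (iter (c * toℕ i) σ fzero)   ≡⟨ cong (iter p σ) (scale-iter-σ c i) ⟨
    iter p σ (scale c i)                  ∎
    where
    open ≡-Reasoning
    p : ℕ
    p = toℕ (f fzero)
    along : ∀ t → f (t mod N) ≡ iter (c * t) σ (f fzero)
    along zero    = cong (λ a → iter a σ (f fzero)) (sym (*-zeroʳ c))
    along (suc t) = begin
      f (suc t mod N)                       ≡⟨ cong f (σ-mod t) ⟨
      f (σ (t mod N))                       ≡⟨ sh (t mod N) ⟩
      iter c σ (f (t mod N))                ≡⟨ cong (iter c σ) (along t) ⟩
      iter c σ (iter (c * t) σ (f fzero))   ≡⟨ iter-+ σ c (c * t) (f fzero) ⟨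
      iter (c + c * t) σ (f fzero)          ≡⟨ cong (λ a → iter a σ (f fzero)) (*-suc c t) ⟨
      iter (c * suc t) σ (f fzero)          ∎

  ∘-σ-perm : Perm N → Perm N
  ∘-σ-perm π = perm (fun π ∘ σ) (σ-injective ∘ inj π)

  fixedClass⇒shifted-σ : ∀ π → FixedClass π → ∃ λ k → Shifted (fun π ∘ σ) (fun π) k
  fixedClass⇒shifted-σ π fixed =
    let k , _ , sh = Equivalence.to (fixed (∘-σ-perm π)) (0 , s≤s z≤n , λ _ → refl)
    in k , sh

  totatives : List ℕ
  totatives = filter (λ k → coprime? k N) (applyUpTo suc N)

  totatives-unique : Unique totatives
  totatives-unique = Unique.filter⁺ (λ k → coprime? k N)
    (Unique.applyUpTo⁺₁ suc N (λ i<j _ → <⇒≢ i<j ∘ suc-injective))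

  ∈-totatives⁺ : ∀ {i} → i < N → Coprime (suc i) N → suc i ∈ totatives
  ∈-totatives⁺ i<N c⊥N = ∈-filter⁺ (λ k → coprime? k N) (∈-applyUpTo⁺ suc i<N) c⊥N

  ∈-totatives⁻ : ∀ {c} → c ∈ totatives → (∃ λ i → i < N × c ≡ suc i) × Coprime c N
  ∈-totatives⁻ c∈ with ∈-filter⁻ (λ k → coprime? k N) c∈
  ... | c∈[1,N] , c⊥N = ∈-applyUpTo⁻ suc c∈[1,N] , c⊥N

  totatives-%-injective : ∀ {c c'} → c ∈ totatives → c' ∈ totatives → c % N ≡ c' % N → c ≡ c'
  totatives-%-injective c∈ c'∈ eq with ∈-totatives⁻ c∈ | ∈-totatives⁻ c'∈
  ... | (i , i<N , refl) , _ | (j , j<N , refl) , _ =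
    cong suc (trans (sym (m<n⇒m%n≡m i<N)) (trans (+-cancelˡ-% 1 i j N eq) (m<n⇒m%n≡m j<N)))

  fixedClass⇒scale : ∀ π → FixedClass π → ∃ λ c → c ∈ totatives × SameClass (fun π) (scale c)
  fixedClass⇒scale π fixed with fixedClass⇒shifted-σ π fixed
  ... | k , πσ≡σᵏπ = c , ∈-totatives⁺ (m%n<n (k + m) N) c⊥N , shifted⇒sameClass {a = p} affine
    where
    open ≡-Reasoning
    -- the representative of k mod N in {1, …, N}
    c : ℕ
    c = suc ((k + m) % N)
    k≡c : k % N ≡ c % N
    k≡c = begin
      k % N                     ≡⟨ [m+n]%n≡m%n k N ⟨
      (k + N) % N               ≡⟨ cong (_% N) (+-suc k m) ⟩
      (1 + (k + m)) % N         ≡⟨ [m+n%d]%d≡[m+n]%d 1 (k + m) N ⟨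
      (1 + (k + m) % N) % N     ∎
    p : ℕ
    p = toℕ (fun π fzero)
    affine : Shifted (fun π) (scale c) p
    affine = shifted-σ⇒affine c (shifted-cong {a = k} {b = c} k≡c πσ≡σᵏπ)
    c⊥N : Coprime c N
    c⊥N = scale-injective⇒coprime c (shifted-injective {a = p} affine (inj π))

lemma5 : (n : ℕ) → 1 ≤ n → NumFixedClasses n (φ n)
lemma5 (suc m) _ = representative , fixed , distinct , complete
  where
  open Cyclic m
  coprime : ∀ j → Coprime (lookup totatives j) N
  coprime j = proj₂ (∈-totatives⁻ (∈-lookup j))
  representative : Fin (length totatives) → Perm N
  representative j = scalePerm (lookup totatives j) (coprime j)
  fixed : ∀ j → FixedClass (representative j)
  fixed j = shifted⇒sameClass {a = lookup totatives j} (scale-∘-σ (lookup totatives j))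
  distinct : ∀ j j' → SameClass (fun (representative j)) (fun (representative j')) → j ≡ j'
  distinct j j' same = lookup-injective totatives-unique
    (totatives-%-injective (∈-lookup j) (∈-lookup j')
      (sameClass-scale⇒≡% (lookup totatives j) (lookup totatives j') (coprime j) same))
  complete : ∀ π → FixedClass π → ∃ λ j → SameClass (fun π) (fun (representative j))
  complete π fixedπ =
    let c , c∈ , same = fixedClass⇒scale π fixedπ
    in index c∈ , subst (λ c → SameClass (fun π) (scale c)) (lookup-index c∈) same
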